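{- Let $\mathcal{L}$ be a class of structures containing the empty structure $\perp$, where each $Z\in\mathcal{L}$ has a finite ground set $V(Z)$ and each $Z\ne\perp$ has a set $R(Z)\subseteq V(Z)$ of removable elements. Consider the algorithm EnumElimOrdering$(Z,S)$: if $|V(Z)|=1$ with $V(Z)=\{z\}$, output the sequence $S$ followed by $z$ and return; otherwise, for each $z\in V(Z)$ with $z\in R(Z)$, recursively call EnumElimOrdering$(Z\setminus z,\ S$ followed by $z)$. If each inner iteration of this algorithm generates at least two recursive calls and takes $O(p(|V(Z)|))$ time, where $p$ is a polynomial, then EnumElimOrdering enumerates the elimination orderings in $O(1)$ amortized time for each.
   Context: For $Z\in\mathcal{L}$, $Z\ne\perp$, and $e\in R(Z)$, removing $e$ from $Z$ yields a uniquely determined structure $Z\setminus e\in\mathcal{L}$ with $V(Z\setminus e)=V(Z)\setminus\{e\}$. An elimination ordering of $Z$ is an ordering $(z_1,\dots,z_n)$ of all elements of $V(Z)$ such that each $z_i$ is removable in the structure obtained from $Z$ by successively removing $z_1,\dots,z_{i-1}$. An iteration is one execution of the procedure excluding its recursive calls; an inner iteration is one that makes at least one recursive call. The algorithm is started as EnumElimOrdering$(Z,\text{empty sequence})$. -}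

module Defs where

open import Data.Nat using (ℕ; zero; suc; _+_; _*_; _≤_)
open import Data.Bool using (Bool; true; false)
open import Data.List using (List; []; _∷_; _∷ʳ_; _++_; length; map; concatMap; filterᵇ)
open import Data.Nat.ListAction using (sum)
open import Data.List.Membership.Propositional using (_∈_)
open import Data.List.Relation.Unary.Unique.Propositional using (Unique)
open import Data.Maybe using (Maybe; just; nothing; maybe)
open import Data.Product using (_×_; ∃-syntax)
open import Relation.Binary.PropositionalEquality using (_≡_; _≢_)
open import Function.Bundles using (_⇔_)

record ElimSystem : Set₁ where
  field
    L      : Set
    E      : Set
    ⊥L     : L
    V      : L → List E
    V-unique : ∀ Z → Unique (V Z)
    V-⊥    : V ⊥L ≡ []
    -- R(Z) as a decidable predicate: e ∈ R(Z) iff e ∈ V Z and removable Z e ≡ true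
    removable : L → E → Bool
    -- Z ∖ e  (only meaningful for removable e)
    remove : L → E → L
    V-remove : ∀ Z e → e ∈ V Z → removable Z e ≡ true →
               ∀ x → (x ∈ V (remove Z e)) ⇔ (x ∈ V Z × x ≢ e)
    R-nonempty : ∀ Z → V Z ≢ [] → ∃[ e ] (e ∈ V Z × removable Z e ≡ true)

module _ (𝓛 : ElimSystem) where
  open ElimSystem 𝓛

  data IsElimOrdering : L → List E → Set where
    done : ∀ {Z} → V Z ≡ [] → IsElimOrdering Z []
    step : ∀ {Z z σ} → z ∈ V Z → removable Z z ≡ true →
           IsElimOrdering (remove Z z) σ → IsElimOrdering Z (z ∷ σ)

  singleton : List E → Maybe E
  singleton (z ∷ []) = just z
  singleton _        = nothing

  callsOf : List E → L → List E
  callsOf (z ∷ []) Z = []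
  callsOf vs       Z = filterᵇ (removable Z) vs

  calls : L → List E
  calls Z = callsOf (V Z) Z

  -- EnumElimOrdering(Z, S) with a fuel argument (fuel |V(Z)| suffices,
  -- since each call removes one element); returns the sequence of outputs.
  enum : ℕ → L → List E → List (List E)
  enum zero    Z S = []
  enum (suc f) Z S =
    maybe (λ z → (S ∷ʳ z) ∷ []) [] (singleton (V Z))
    ++ concatMap (λ z → enum f (remove Z z) (S ∷ʳ z)) (calls Z)

  EnumElimOrdering : L → List (List E)
  EnumElimOrdering Z = enum (length (V Z)) Z []

  time : (L → ℕ) → ℕ → L → ℕ
  time cost zero    Z = 0
  time cost (suc f) Z = cost Z + sum (map (λ z → time cost f (remove Z z)) (calls Z))

  totalTime : (L → ℕ) → L → ℕ
  totalTime cost Z = time cost (length (V Z)) Z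

-- polynomials with natural-number coefficients (constant term first)
evalPoly : List ℕ → ℕ → ℕ
evalPoly []       n = 0
evalPoly (a ∷ as) n = a + n * evalPoly as n

-- Correctness and duplicate-freeness follow by induction along the recursion tree,
-- since distinct recursive calls of one iteration extend S by distinct elements.
-- For the running time, give an iteration on a structure with n elements the
-- potential Ψ(n), where G(n+1) + Ψ(n+1) ≤ 2 Ψ(n) and G bounds the cost of an inner
-- iteration. An inner iteration has at least two children, whose potentials Ψ(n−1)
-- pay for its cost and for its own potential; hence time + Ψ(|V(Z)|) ≤ C · #outputs.
-- For a polynomial cost bound, Ψ is a weighted sum of binomial coefficients.
module Submission where

open import Defs
open import Data.Nat using (ℕ; zero; suc; _+_; _*_; _≤_; _<_; z≤n; s≤s)
open import Data.Nat.Properties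
open import Data.Nat.ListAction using (sum)
open import Data.Nat.Solver using (module +-*-Solver)
open import Data.Bool using (true; T?)
open import Data.Bool.Properties using (T-≡)
open import Data.List using (List; []; _∷_; _∷ʳ_; _++_; length; map; concatMap)
open import Data.List.Properties using (length-++; ++-assoc; ++-cancelˡ; ∷-injectiveˡ)
open import Data.List.Membership.Propositional using (_∈_; lose; find)
open import Data.List.Membership.Propositional.Properties
  using (∈-++⁻; ∈-++⁺ˡ; ∈-++⁺ʳ; ∈-concatMap⁺; ∈-concatMap⁻; ∈-filter⁺; ∈-filter⁻; ∈-length)
open import Data.List.Membership.Propositional.Properties.WithK using (unique∧set⇒bag)
open import Data.List.Relation.Binary.BagAndSetEquality using (_∼[_]_; set; ∼bag⇒↭)
open import Data.List.Relation.Binary.Permutation.Propositional.Properties using (↭-length)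
open import Data.List.Relation.Binary.Disjoint.Propositional using (Disjoint)
open import Data.List.Relation.Unary.Any using (here; there)
import Data.List.Relation.Unary.All as All
import Data.List.Relation.Unary.All.Properties as All
open import Data.List.Relation.Unary.AllPairs using ([]; _∷_)
import Data.List.Relation.Unary.AllPairs as AllPairs
import Data.List.Relation.Unary.AllPairs.Properties as AllPairs
open import Data.List.Relation.Unary.Unique.Propositional using (Unique)
open import Data.List.Relation.Unary.Unique.Propositional.Properties using (concat⁺; filter⁺)
open import Data.Maybe using (maybe)
open import Data.Product using (_×_; _,_; proj₁; proj₂; map₂; ∃-syntax)
open import Data.Sum using (inj₁; inj₂)
open import Data.Empty using (⊥-elim)
open import Relation.Nullary using (Dec; yes; no)
open import Relation.Binary.PropositionalEquality
open import Function.Bundles using (_⇔_; mk⇔; Equivalence)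
open import Function.Base using (_∘_; case_of_)

open +-*-Solver using (solve; _:+_; _:*_; _:=_; con)
open Equivalence using (to; from)

module _ {A : Set} where

  unique-∈-≟ : ∀ {xs : List A} {x y} → Unique xs → x ∈ xs → y ∈ xs → Dec (x ≡ y)
  unique-∈-≟ _          (here refl) (here refl) = yes refl
  unique-∈-≟ (x∉ ∷ _)   (here refl) (there y∈)  = no λ x≡y → All.lookup x∉ y∈ x≡y
  unique-∈-≟ (y∉ ∷ _)   (there x∈)  (here refl) = no λ x≡y → All.lookup y∉ x∈ (sym x≡y)
  unique-∈-≟ (_ ∷ uxs)  (there x∈)  (there y∈)  = unique-∈-≟ uxs x∈ y∈

  length-remove : ∀ {xs ys : List A} {e} → Unique xs → Unique ys → e ∈ xs →
                  (∀ x → (x ∈ ys) ⇔ (x ∈ xs × x ≢ e)) → length xs ≡ suc (length ys)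
  length-remove {xs} {ys} {e} uxs uys e∈xs ys≈xs∖e =
    ↭-length (∼bag⇒↭ (unique∧set⇒bag uxs (e∉ys ∷ uys) xs≈e∷ys))
    where
    e∉ys : All.All (e ≢_) ys
    e∉ys = All.tabulate λ y∈ys e≡y → proj₂ (to (ys≈xs∖e _) y∈ys) (sym e≡y)

    forward : ∀ {x} → x ∈ xs → x ∈ e ∷ ys
    forward x∈xs with unique-∈-≟ uxs x∈xs e∈xs
    ... | yes x≡e = here x≡e
    ... | no  x≢e = there (from (ys≈xs∖e _) (x∈xs , x≢e))

    backward : ∀ {x} → x ∈ e ∷ ys → x ∈ xs
    backward (here refl)  = e∈xs
    backward (there x∈ys) = proj₁ (to (ys≈xs∖e _) x∈ys)

    xs≈e∷ys : xs ∼[ set ] (e ∷ ys)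
    xs≈e∷ys = mk⇔ forward backward

  ∈-length≡1⇒≡[_] : ∀ {xs : List A} {x} → x ∈ xs → length xs ≡ 1 → xs ≡ x ∷ []
  ∈-length≡1⇒≡[_] {_ ∷ []} (here refl) _ = refl

  length≡1⇒singleton : ∀ {xs : List A} → length xs ≡ 1 → ∃[ x ] (xs ≡ x ∷ [])
  length≡1⇒singleton {x ∷ []} _ = x , refl

  length≡0⇒≡[] : ∀ {xs : List A} → length xs ≡ 0 → xs ≡ []
  length≡0⇒≡[] {[]} _ = refl

  concatMap-unique : ∀ {B : Set} (g : A → List B) {xs} → Unique xs → (∀ x → Unique (g x)) →
                     (∀ {x y} → x ≢ y → Disjoint (g x) (g y)) → Unique (concatMap g xs)
  concatMap-unique g {xs} uxs ug disjoint =
    concat⁺ (All.map⁺ (All.universal ug xs)) (AllPairs.map⁺ (AllPairs.map disjoint uxs))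

  length-concatMap : ∀ {B : Set} (g : A → List B) xs →
                     length (concatMap g xs) ≡ sum (map (length ∘ g) xs)
  length-concatMap g []       = refl
  length-concatMap g (x ∷ xs) = trans (length-++ (g x)) (cong (length (g x) +_) (length-concatMap g xs))

  sum-pointwise-≤ : ∀ (k φ : ℕ) (a b : A → ℕ) xs → (∀ {x} → x ∈ xs → a x + φ ≤ k * b x) →
                    sum (map a xs) + length xs * φ ≤ k * sum (map b xs)
  sum-pointwise-≤ k φ a b []       _ = ≤-reflexive (sym (*-zeroʳ k))
  sum-pointwise-≤ k φ a b (x ∷ xs) h = begin
      (a x + Σa) + (φ + length xs * φ)
    ≡⟨ solve 4 (λ p q r s → (p :+ q) :+ (r :+ s) := (p :+ r) :+ (q :+ s)) refl (a x) Σa φ (length xs * φ) ⟩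
      (a x + φ) + (Σa + length xs * φ)
    ≤⟨ +-mono-≤ (h (here refl)) (sum-pointwise-≤ k φ a b xs (h ∘ there)) ⟩
      k * b x + k * sum (map b xs)
    ≡⟨ *-distribˡ-+ k (b x) _ ⟨
      k * (b x + sum (map b xs)) ∎
    where
    open ≤-Reasoning
    Σa : ℕ
    Σa = sum (map a xs)

module _ (𝓛 : ElimSystem) where
  open ElimSystem 𝓛

  outputs : List E → List E → List (List E)
  outputs vs S = maybe (λ z → (S ∷ʳ z) ∷ []) [] (singleton 𝓛 vs)

  branch : ℕ → L → List E → E → List (List E)
  branch f Z S z = enum 𝓛 f (remove Z z) (S ∷ʳ z)

  ∈-outputs⁺ : ∀ {vs S x} → vs ≡ x ∷ [] → S ∷ʳ x ∈ outputs vs S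
  ∈-outputs⁺ refl = here refl

  ∈-outputs⁻ : ∀ vs {S σ} → σ ∈ outputs vs S → ∃[ x ] (vs ≡ x ∷ [] × σ ≡ S ∷ʳ x)
  ∈-outputs⁻ (x ∷ [])     (here σ≡) = x , refl , σ≡
  ∈-outputs⁻ (x ∷ [])     (there ())
  ∈-outputs⁻ (_ ∷ _ ∷ _)  ()

  ∈-callsOf⁺ : ∀ {vs Z z} → 2 ≤ length vs → z ∈ vs → removable Z z ≡ true → z ∈ callsOf 𝓛 vs Z
  ∈-callsOf⁺ {_ ∷ []}    (s≤s ())
  ∈-callsOf⁺ {_ ∷ _ ∷ _} {Z} _ z∈vs r = ∈-filter⁺ (T? ∘ removable Z) z∈vs (from T-≡ r)

  ∈-callsOf⁻ : ∀ vs {Z z} → z ∈ callsOf 𝓛 vs Z → z ∈ vs × removable Z z ≡ true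
  ∈-callsOf⁻ (x ∷ y ∷ ys) {Z} z∈ with ∈-filter⁻ (T? ∘ removable Z) {xs = x ∷ y ∷ ys} z∈
  ... | z∈vs , Tr = z∈vs , to T-≡ Tr

  calls-singleton : ∀ {Z x} → V Z ≡ x ∷ [] → calls 𝓛 Z ≡ []
  calls-singleton {Z} eq = cong (λ vs → callsOf 𝓛 vs Z) eq

  calls-nonempty : ∀ {Z} → 2 ≤ length (V Z) → 0 < length (calls 𝓛 Z)
  calls-nonempty {Z} 2≤ with R-nonempty Z (λ V≡[] → <⇒≱ 2≤ (≤-trans (≤-reflexive (cong length V≡[])) z≤n))
  ... | e , e∈V , r = ∈-length (∈-callsOf⁺ 2≤ e∈V r)

  length-V-remove : ∀ {Z z} → z ∈ V Z → removable Z z ≡ true →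
                    length (V Z) ≡ suc (length (V (remove Z z)))
  length-V-remove {Z} {z} z∈V r = length-remove (V-unique Z) (V-unique (remove Z z)) z∈V (V-remove Z z z∈V r)

  length-V-remove-call : ∀ {Z z} → z ∈ calls 𝓛 Z → length (V Z) ≡ suc (length (V (remove Z z)))
  length-V-remove-call {Z} z∈calls = let z∈V , r = ∈-callsOf⁻ (V Z) z∈calls in length-V-remove z∈V r

  singleton-elimOrdering : ∀ {Z x} → V Z ≡ x ∷ [] → IsElimOrdering 𝓛 Z (x ∷ [])
  singleton-elimOrdering {Z} {x} V≡[x] with R-nonempty Z (λ V≡[] → case trans (sym V≡[x]) V≡[] of λ ())
  ... | e , e∈V , r with subst (e ∈_) V≡[x] e∈V
  ... | here refl = step e∈V r (done (length≡0⇒≡[] |V′|≡0))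
    where
    |V′|≡0 : length (V (remove Z e)) ≡ 0
    |V′|≡0 = suc-injective (trans (sym (length-V-remove e∈V r)) (cong length V≡[x]))

  ∈-enum⁻ : ∀ f Z S {σ} → σ ∈ enum 𝓛 f Z S → ∃[ τ ] (σ ≡ S ++ τ × IsElimOrdering 𝓛 Z τ)
  ∈-enum⁻ (suc f) Z S σ∈ with ∈-++⁻ (outputs (V Z) S) σ∈
  ... | inj₁ σ∈out with ∈-outputs⁻ (V Z) σ∈out
  ...   | x , V≡[x] , refl = x ∷ [] , refl , singleton-elimOrdering V≡[x]
  ∈-enum⁻ (suc f) Z S σ∈ | inj₂ σ∈branches with find (∈-concatMap⁻ (branch f Z S) {xs = calls 𝓛 Z} σ∈branches)
  ... | z , z∈calls , σ∈branch with ∈-callsOf⁻ (V Z) z∈calls | ∈-enum⁻ f (remove Z z) (S ∷ʳ z) σ∈branch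
  ...   | z∈V , r | τ , refl , elim = z ∷ τ , ++-assoc S (z ∷ []) τ , step z∈V r elim

  ∈-enum⁺ : ∀ f Z S {z τ} → length (V Z) ≤ f → IsElimOrdering 𝓛 Z (z ∷ τ) → S ++ z ∷ τ ∈ enum 𝓛 f Z S
  ∈-enum⁺ zero    Z S ≤f (step z∈V _ _) = ⊥-elim (<⇒≱ (∈-length z∈V) ≤f)
  ∈-enum⁺ (suc f) Z S ≤f (step z∈V r (done V′≡[])) =
    ∈-++⁺ˡ (∈-outputs⁺ (∈-length≡1⇒≡[ z∈V ] (trans (length-V-remove z∈V r) (cong (suc ∘ length) V′≡[]))))
  ∈-enum⁺ (suc f) Z S {z} {τ} ≤f (step z∈V r elim@(step z′∈V′ _ _)) =
    ∈-++⁺ʳ (outputs (V Z) S) (∈-concatMap⁺ (branch f Z S) (lose z∈calls (subst (_∈ branch f Z S z) S∷ʳz++τ≡ rest∈)))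
    where
    |V|≡ : length (V Z) ≡ suc (length (V (remove Z z)))
    |V|≡ = length-V-remove z∈V r

    z∈calls : z ∈ calls 𝓛 Z
    z∈calls = ∈-callsOf⁺ (subst (2 ≤_) (sym |V|≡) (s≤s (∈-length z′∈V′))) z∈V r

    S∷ʳz++τ≡ : (S ∷ʳ z) ++ τ ≡ S ++ z ∷ τ
    S∷ʳz++τ≡ = ++-assoc S (z ∷ []) τ

    rest∈ : (S ∷ʳ z) ++ τ ∈ branch f Z S z
    rest∈ = ∈-enum⁺ f (remove Z z) (S ∷ʳ z) (≤-pred (subst (_≤ suc f) |V|≡ ≤f)) elim

  branches-disjoint : ∀ f Z S {z z′} → z ≢ z′ → Disjoint (branch f Z S z) (branch f Z S z′)
  branches-disjoint f Z S {z} {z′} z≢z′ (σ∈ , σ∈′)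
    with ∈-enum⁻ f (remove Z z) (S ∷ʳ z) σ∈ | ∈-enum⁻ f (remove Z z′) (S ∷ʳ z′) σ∈′
  ... | τ , σ≡ , _ | τ′ , σ≡′ , _ = z≢z′ (∷-injectiveˡ (++-cancelˡ S (z ∷ τ) (z′ ∷ τ′) (begin
      S ++ z ∷ τ       ≡⟨ ++-assoc S (z ∷ []) τ ⟨
      (S ∷ʳ z) ++ τ    ≡⟨ trans (sym σ≡) σ≡′ ⟩
      (S ∷ʳ z′) ++ τ′  ≡⟨ ++-assoc S (z′ ∷ []) τ′ ⟩
      S ++ z′ ∷ τ′     ∎)))
    where open ≡-Reasoning

  enum-unique : ∀ f Z S → Unique (enum 𝓛 f Z S)
  enum-unique zero    Z S = []
  enum-unique (suc f) Z S = iteration-unique (V Z) (V-unique Z)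
    where
    iteration-unique : ∀ vs → Unique vs → Unique (outputs vs S ++ concatMap (branch f Z S) (callsOf 𝓛 vs Z))
    iteration-unique []          _   = []
    iteration-unique (_ ∷ [])    _   = All.[] ∷ []
    iteration-unique (_ ∷ _ ∷ _) uvs =
      concatMap-unique (branch f Z S) (filter⁺ (T? ∘ removable Z) uvs)
        (λ z → enum-unique f (remove Z z) (S ∷ʳ z)) (branches-disjoint f Z S)

  EnumElimOrdering-correct : ∀ Z → V Z ≢ [] → ∀ σ → (σ ∈ EnumElimOrdering 𝓛 Z) ⇔ IsElimOrdering 𝓛 Z σ
  EnumElimOrdering-correct Z V≢[] σ = mk⇔ enumerated⇒elim elim⇒enumerated
    where
    enumerated⇒elim : σ ∈ EnumElimOrdering 𝓛 Z → IsElimOrdering 𝓛 Z σ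
    enumerated⇒elim σ∈ with ∈-enum⁻ (length (V Z)) Z [] σ∈
    ... | τ , refl , elim = elim

    elim⇒enumerated : IsElimOrdering 𝓛 Z σ → σ ∈ EnumElimOrdering 𝓛 Z
    elim⇒enumerated (done V≡[])       = ⊥-elim (V≢[] V≡[])
    elim⇒enumerated elim@(step _ _ _) = ∈-enum⁺ (length (V Z)) Z [] ≤-refl elim

  module Amortised (cost : L → ℕ) (c : ℕ) (G Ψ : ℕ → ℕ)
    (inner-cost : ∀ Z → 1 ≤ length (calls 𝓛 Z) → 2 ≤ length (calls 𝓛 Z) × cost Z ≤ G (length (V Z)))
    (leaf-cost : ∀ Z → calls 𝓛 Z ≡ [] → cost Z ≤ c)
    (Ψ-step : ∀ n → G (suc n) + Ψ (suc n) ≤ 2 * Ψ n) where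

    C : ℕ
    C = c + Ψ 1

    leaf-step : ∀ f Z S → length (V Z) ≡ 1 → time 𝓛 cost (suc f) Z + Ψ 1 ≤ C * length (enum 𝓛 (suc f) Z S)
    leaf-step f Z S |V|≡1 with length≡1⇒singleton |V|≡1
    ... | x , V≡[x] = begin
        cost Z + sum (map (time 𝓛 cost f ∘ remove Z) (calls 𝓛 Z)) + Ψ 1
      ≡⟨ cong (λ cs → cost Z + sum (map (time 𝓛 cost f ∘ remove Z) cs) + Ψ 1) (calls-singleton V≡[x]) ⟩
        cost Z + 0 + Ψ 1
      ≤⟨ +-monoˡ-≤ (Ψ 1) (≤-trans (≤-reflexive (+-identityʳ (cost Z))) (leaf-cost Z (calls-singleton V≡[x]))) ⟩
        C
      ≡⟨ *-identityʳ C ⟨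
        C * 1
      ≤⟨ *-monoʳ-≤ C (∈-length (∈-++⁺ˡ {ys = concatMap (branch f Z S) (calls 𝓛 Z)} (∈-outputs⁺ {S = S} V≡[x]))) ⟩
        C * length (enum 𝓛 (suc f) Z S) ∎
      where open ≤-Reasoning

    inner-step : ∀ f Z S n → length (V Z) ≡ 2 + n →
      (∀ {z} → z ∈ calls 𝓛 Z → time 𝓛 cost f (remove Z z) + Ψ (suc n) ≤ C * length (branch f Z S z)) →
      time 𝓛 cost (suc f) Z + Ψ (2 + n) ≤ C * length (enum 𝓛 (suc f) Z S)
    inner-step f Z S n |V|≡ branch-bound = begin
        cost Z + Σtime + Ψ (2 + n)
      ≤⟨ +-monoˡ-≤ (Ψ (2 + n)) (+-monoˡ-≤ Σtime cost≤G) ⟩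
        G (2 + n) + Σtime + Ψ (2 + n)
      ≡⟨ solve 3 (λ g t p → g :+ t :+ p := t :+ (g :+ p)) refl (G (2 + n)) Σtime (Ψ (2 + n)) ⟩
        Σtime + (G (2 + n) + Ψ (2 + n))
      ≤⟨ +-monoʳ-≤ Σtime (≤-trans (Ψ-step (suc n)) (*-monoˡ-≤ (Ψ (suc n)) 2≤calls)) ⟩
        Σtime + length cs * Ψ (suc n)
      ≤⟨ sum-pointwise-≤ C (Ψ (suc n)) (time 𝓛 cost f ∘ remove Z) (length ∘ branch f Z S) cs branch-bound ⟩
        C * sum (map (length ∘ branch f Z S) cs)
      ≡⟨ cong (C *_) (length-concatMap (branch f Z S) cs) ⟨
        C * length (concatMap (branch f Z S) cs)
      ≤⟨ *-monoʳ-≤ C (≤-trans (m≤n+m _ _) (≤-reflexive (sym (length-++ (outputs (V Z) S))))) ⟩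
        C * length (enum 𝓛 (suc f) Z S) ∎
      where
      open ≤-Reasoning
      cs : List E
      cs = calls 𝓛 Z

      Σtime : ℕ
      Σtime = sum (map (time 𝓛 cost f ∘ remove Z) cs)

      inner : 2 ≤ length cs × cost Z ≤ G (length (V Z))
      inner = inner-cost Z (calls-nonempty (subst (2 ≤_) (sym |V|≡) (s≤s (s≤s z≤n))))

      2≤calls : 2 ≤ length cs
      2≤calls = proj₁ inner

      cost≤G : cost Z ≤ G (2 + n)
      cost≤G = subst (λ m → cost Z ≤ G m) |V|≡ (proj₂ inner)

    time+Ψ≤C*outputs : ∀ f Z S → 1 ≤ length (V Z) → length (V Z) ≤ f →
                       time 𝓛 cost f Z + Ψ (length (V Z)) ≤ C * length (enum 𝓛 f Z S)
    time+Ψ≤C*outputs zero Z S 1≤ ≤f = ⊥-elim (<⇒≱ 1≤ ≤f)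
    time+Ψ≤C*outputs (suc f) Z S 1≤ ≤f with length (V Z) in |V|≡
    ... | suc zero    = leaf-step f Z S |V|≡
    ... | suc (suc n) = inner-step f Z S n |V|≡ branch-bound
      where
      branch-bound : ∀ {z} → z ∈ calls 𝓛 Z → time 𝓛 cost f (remove Z z) + Ψ (suc n) ≤ C * length (branch f Z S z)
      branch-bound {z} z∈calls =
        subst (λ m → time 𝓛 cost f (remove Z z) + Ψ m ≤ C * length (branch f Z S z)) |V′|≡
          (time+Ψ≤C*outputs f (remove Z z) (S ∷ʳ z)
            (subst (1 ≤_) (sym |V′|≡) (s≤s z≤n)) (subst (_≤ f) (sym |V′|≡) (≤-pred ≤f)))
        where
        |V′|≡ : length (V (remove Z z)) ≡ suc n
        |V′|≡ = suc-injective (trans (sym (length-V-remove-call z∈calls)) |V|≡)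

    totalTime≤C*outputs : ∀ Z → V Z ≢ [] → totalTime 𝓛 cost Z ≤ C * length (EnumElimOrdering 𝓛 Z)
    totalTime≤C*outputs Z V≢[] =
      ≤-trans (m≤m+n _ _) (time+Ψ≤C*outputs (length (V Z)) Z [] (n≢0⇒n>0 (V≢[] ∘ length≡0⇒≡[])) ≤-refl)

-- binom L n = C(n + L, L), given by Pascal's rule.
binom : ℕ → ℕ → ℕ
binom zero    n       = 1
binom (suc L) zero    = 1
binom (suc L) (suc n) = binom L (suc n) + binom (suc L) n

-- potential L n = Σ_{j ≤ L} 2^(L − j) C(n + j, j)
potential : ℕ → ℕ → ℕ
potential zero    n = 1
potential (suc L) n = binom (suc L) n + 2 * potential L n

potential-step : ∀ L n → binom L (suc n) + potential L (suc n) ≡ 2 * potential L n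
potential-step zero    n = refl
potential-step (suc L) n = begin
    (b + b′) + ((b + b′) + 2 * p)
  ≡⟨ solve 3 (λ b b′ p → (b :+ b′) :+ ((b :+ b′) :+ con 2 :* p) := con 2 :* b′ :+ con 2 :* (b :+ p)) refl b b′ p ⟩
    2 * b′ + 2 * (b + p)
  ≡⟨ cong (λ q → 2 * b′ + 2 * q) (potential-step L n) ⟩
    2 * b′ + 2 * (2 * potential L n)
  ≡⟨ *-distribˡ-+ 2 b′ (2 * potential L n) ⟨
    2 * (b′ + 2 * potential L n) ∎
  where
  open ≡-Reasoning
  b b′ p : ℕ
  b  = binom L (suc n)
  b′ = binom (suc L) n
  p  = potential L (suc n)

binom-positive : ∀ L n → 1 ≤ binom L n
binom-positive zero    n       = s≤s z≤n
binom-positive (suc L) zero    = s≤s z≤n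
binom-positive (suc L) (suc n) = ≤-trans (binom-positive L (suc n)) (m≤m+n _ _)

-- (L + 1) C(n + L + 1, L + 1) = (n + L + 1) C(n + L, L)
*-binom-≤ : ∀ n L → n * binom L n ≤ suc L * binom (suc L) n
*-binom-≤ zero    L       = z≤n
*-binom-≤ (suc n) zero    = s≤s (*-binom-≤ n zero)
*-binom-≤ (suc n) (suc L) = begin
    suc n * (a + b)
  ≡⟨ solve 3 (λ n a b → (con 1 :+ n) :* (a :+ b) := (con 1 :+ n) :* a :+ (b :+ n :* b)) refl n a b ⟩
    suc n * a + (b + n * b)
  ≤⟨ +-mono-≤ (*-binom-≤ (suc n) L) (+-monoʳ-≤ b (*-binom-≤ n (suc L))) ⟩
    suc L * (a + b) + (b + suc (suc L) * d)
  ≤⟨ +-monoʳ-≤ (suc L * (a + b)) (+-monoˡ-≤ (suc (suc L) * d) (m≤n+m b a)) ⟩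
    suc L * (a + b) + ((a + b) + suc (suc L) * d)
  ≡⟨ solve 4 (λ L a b d → (con 1 :+ L) :* (a :+ b) :+ ((a :+ b) :+ (con 2 :+ L) :* d)
                          := (con 2 :+ L) :* ((a :+ b) :+ d)) refl L a b d ⟩
    suc (suc L) * ((a + b) + d) ∎
  where
  open ≤-Reasoning
  a b d : ℕ
  a = binom L (suc n)
  b = binom (suc L) n
  d = binom (suc (suc L)) n

polyBound : List ℕ → ℕ
polyBound []       = 0
polyBound (a ∷ as) = a + suc (length as) * polyBound as

evalPoly≤polyBound*binom : ∀ p n → evalPoly p n ≤ polyBound p * binom (length p) n
evalPoly≤polyBound*binom []       n = z≤n
evalPoly≤polyBound*binom (a ∷ as) n = begin
    a + n * evalPoly as n
  ≤⟨ +-mono-≤ (≤-trans (≤-reflexive (sym (*-identityʳ a))) (*-monoʳ-≤ a (binom-positive (suc L) n)))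
              (*-monoʳ-≤ n (evalPoly≤polyBound*binom as n)) ⟩
    a * H + n * (B * binom L n)
  ≡⟨ cong (a * H +_) (solve 3 (λ n B x → n :* (B :* x) := B :* (n :* x)) refl n B (binom L n)) ⟩
    a * H + B * (n * binom L n)
  ≤⟨ +-monoʳ-≤ (a * H) (*-monoʳ-≤ B (*-binom-≤ n L)) ⟩
    a * H + B * (suc L * H)
  ≡⟨ solve 4 (λ a H B L → a :* H :+ B :* (L :* H) := (a :+ L :* B) :* H) refl a H B (suc L) ⟩
    (a + suc L * B) * H ∎
  where
  open ≤-Reasoning
  L B H : ℕ
  L = length as
  B = polyBound as
  H = binom (suc L) n

polyCost : ℕ → List ℕ → ℕ → ℕ
polyCost c p n = c * polyBound p * binom (length p) n

polyPotential : ℕ → List ℕ → ℕ → ℕ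
polyPotential c p n = c * polyBound p * potential (length p) n

*-evalPoly≤polyCost : ∀ c p n → c * evalPoly p n ≤ polyCost c p n
*-evalPoly≤polyCost c p n = begin
  c * evalPoly p n                            ≤⟨ *-monoʳ-≤ c (evalPoly≤polyBound*binom p n) ⟩
  c * (polyBound p * binom (length p) n)      ≡⟨ *-assoc c (polyBound p) _ ⟨
  polyCost c p n                              ∎
  where open ≤-Reasoning

polyPotential-step : ∀ c p n → polyCost c p (suc n) + polyPotential c p (suc n) ≡ 2 * polyPotential c p n
polyPotential-step c p n = begin
    k * binom D (suc n) + k * potential D (suc n)
  ≡⟨ *-distribˡ-+ k _ _ ⟨
    k * (binom D (suc n) + potential D (suc n))
  ≡⟨ cong (k *_) (potential-step D n) ⟩
    k * (2 * potential D n)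
  ≡⟨ solve 2 (λ k q → k :* (con 2 :* q) := con 2 :* (k :* q)) refl k (potential D n) ⟩
    2 * (k * potential D n) ∎
  where
  open ≡-Reasoning
  k D : ℕ
  k = c * polyBound p
  D = length p

corollary1 : (𝓛 : ElimSystem) (cost : ElimSystem.L 𝓛 → ℕ) (p : List ℕ) (c : ℕ) →
    (∀ Z → 1 ≤ length (calls 𝓛 Z) →
      2 ≤ length (calls 𝓛 Z) × cost Z ≤ c * evalPoly p (length (ElimSystem.V 𝓛 Z))) →
    (∀ Z → calls 𝓛 Z ≡ [] → cost Z ≤ c) →
    ∃[ C ] (∀ Z → ElimSystem.V 𝓛 Z ≢ [] →
      (∀ σ → (σ ∈ EnumElimOrdering 𝓛 Z) ⇔ IsElimOrdering 𝓛 Z σ) ×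
      Unique (EnumElimOrdering 𝓛 Z) ×
      totalTime 𝓛 cost Z ≤ C * length (EnumElimOrdering 𝓛 Z))
corollary1 𝓛 cost p c inner-cost leaf-cost = C , λ Z V≢[] →
  EnumElimOrdering-correct 𝓛 Z V≢[] , enum-unique 𝓛 (length (V Z)) Z [] , totalTime≤C*outputs Z V≢[]
  where
  open ElimSystem 𝓛 using (V)

  inner-polyCost : ∀ Z → 1 ≤ length (calls 𝓛 Z) → 2 ≤ length (calls 𝓛 Z) × cost Z ≤ polyCost c p (length (V Z))
  inner-polyCost Z 1≤calls = map₂ (λ cost≤ → ≤-trans cost≤ (*-evalPoly≤polyCost c p _)) (inner-cost Z 1≤calls)

  open Amortised 𝓛 cost c (polyCost c p) (polyPotential c p) inner-polyCost leaf-cost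
    (≤-reflexive ∘ polyPotential-step c p)
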